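{- Let $\Omega$ be a countably infinite set and let $G$ be a group of permutations of $\Omega$ with locally finite algebraic closure. Suppose that the centre $Z(G)$ of $G$ is non-trivial. Then the semigroup Zariski topology on $\overline{G}$ is not Hausdorff. Likewise, the semigroup Zariski topology on $G$ is not Hausdorff.
   Context: $\Omega^\Omega$ is the monoid of all maps $\Omega\to\Omega$ under composition, equipped with the topology of pointwise convergence $\tau_{pw}$ (the product topology, $\Omega$ being discrete); $\overline{G}$ denotes the closure of $G$ in $\Omega^\Omega$ with respect to $\tau_{pw}$, which is a monoid. For a finite $B\subseteq\Omega$, $G_B$ denotes the pointwise stabiliser of $B$ in $G$, and $\mathrm{acl}(B)$ is the set of points of $\Omega$ whose orbit under $G_B$ is finite. $G$ has locally finite algebraic closure if $\mathrm{acl}(B)$ is finite for every finite $B\subseteq\Omega$. For a monoid $S$, the semigroup Zariski topology on $S$ is the topology generated by the solution sets (in one variable $s$) of all inequalities of the form $\lambda_n s\lambda_{n-1}s\cdots\lambda_1 s\lambda_0\neq \eta_m s\eta_{m-1}s\cdots \eta_1 s\eta_0$ with $n,m\ge 0$ and $\lambda_i,\eta_j\in S$. -}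

module Defs where

open import Data.Nat using (ℕ; _<_)
open import Data.List using (List; []; _∷_)
open import Data.List.NonEmpty using (List⁺; _∷_)
open import Data.List.Relation.Unary.All using (All)
open import Data.List.Membership.Propositional using (_∈_)
open import Data.Product using (Σ; _×_; _,_; proj₁; proj₂)
open import Data.Empty using (⊥)
open import Relation.Binary.PropositionalEquality using (_≡_)
open import Relation.Nullary using (¬_)
open import Function using (_∘_; id)

-- Ω is taken to be ℕ (a fixed countably infinite set); Ω^Ω = ℕ → ℕ.
Map : Set
Map = ℕ → ℕ

infix 4 _≈_
_≈_ : Map → Map → Set
f ≈ g = ∀ x → f x ≡ g x

Subset : Set₁
Subset = Map → Set

record PermGroup : Set₁ where
  field
    mem   : Map → Set
    resp  : ∀ {f g} → f ≈ g → mem f → mem g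
    id∈   : mem id
    comp∈ : ∀ {f g} → mem f → mem g → mem (f ∘ g)
    inv∈  : ∀ {f} → mem f → Σ Map (λ h → mem h × (h ∘ f ≈ id) × (f ∘ h ≈ id))
open PermGroup public

FiniteSet : (ℕ → Set) → Set
FiniteSet P = Σ (List ℕ) (λ L → ∀ x → P x → x ∈ L)

Fixes : List ℕ → Map → Set
Fixes B g = ∀ b → b ∈ B → g b ≡ b

acl : PermGroup → List ℕ → ℕ → Set
acl G B x = FiniteSet (λ y → Σ Map (λ g → mem G g × Fixes B g × (g x ≡ y)))

LocallyFiniteAcl : PermGroup → Set
LocallyFiniteAcl G = ∀ (B : List ℕ) → FiniteSet (acl G B)

NontrivialCentre : PermGroup → Set
NontrivialCentre G =
  Σ Map (λ z → mem G z × ¬ (z ≈ id) × (∀ g → mem G g → (z ∘ g) ≈ (g ∘ z)))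

-- closure of G in Ω^Ω w.r.t. pointwise convergence: every basic
-- neighbourhood (agreement on {0,…,n-1}) of f meets G
closure : PermGroup → Subset
closure G f = ∀ (n : ℕ) → Σ Map (λ g → mem G g × (∀ x → x < n → g x ≡ f x))

-- words  λ_n s λ_{n-1} s ⋯ λ_1 s λ_0  as non-empty lists λ_n ∷ … ∷ λ_0
evalL : Map → List Map → Map → Map
evalL l [] s = l
evalL l (m ∷ ms) s = l ∘ s ∘ evalL m ms s

evalW : List⁺ Map → Map → Map
evalW (l ∷ ls) s = evalL l ls s

WordIn : Subset → List⁺ Map → Set
WordIn S (l ∷ ls) = S l × All S ls

-- a subbasic closed-set-complement: a pair of words with coefficients in S
Ineq : Subset → Set
Ineq S = Σ (List⁺ Map × List⁺ Map) (λ p → WordIn S (proj₁ p) × WordIn S (proj₂ p))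

Solves : {S : Subset} → Ineq S → Map → Set
Solves ((w₁ , w₂) , _) s = ¬ (evalW w₁ s ≈ evalW w₂ s)

InBasic : (S : Subset) → List (Ineq S) → Map → Set
InBasic S L s = S s × All (λ i → Solves {S} i s) L

ZOpen : (S : Subset) → Subset → Set
ZOpen S U = (∀ s → U s → S s) ×
            (∀ s → U s → Σ (List (Ineq S)) (λ L → InBasic S L s × (∀ t → InBasic S L t → U t)))

ZariskiHausdorff : Subset → Set₁
ZariskiHausdorff S =
  ∀ x y → S x → S y → ¬ (x ≈ y) →
  Σ Subset (λ U → Σ Subset (λ V →
    ZOpen S U × ZOpen S V × U x × V y × (∀ t → U t → V t → ⊥)))

{-# OPTIONS --safe #-}
module Submission where

-- Let z ≠ id be central in G. The elements of G, and their pointwise limits, are injective and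
-- commute with z. We show that every basic Zariski neighbourhood of id meets every basic
-- neighbourhood of z, in a point z ∘ g with g ∈ G.
-- If both sides of an inequality w₁(s) ≠ w₂(s) contain s the same number d of times, then
-- wᵢ(z ∘ g) = z^d ∘ wᵢ(g); so the inequality holds at z iff it holds at id, and then it holds at
-- z ∘ g for every g ∈ G agreeing with id on a finite set.
-- If the numbers differ, the inequality holds at z ∘ g for g in a dense open subset of G: reading
-- both words from the inside out, local finiteness of acl lets one perturb g step by step so that
-- the arguments fed to s are never algebraic over the finitely many points fixed so far, until
-- the shorter word is used up.
-- A nonempty open subset of G meets every finite intersection of dense open subsets.
-- The choices involved are classical, so the argument runs in the double-negation monad; this is
-- harmless since the goal is ⊥.

open import Defs

open import Data.List using (List; []; _∷_; _++_; _∷ʳ_; map; length; foldl)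
open import Data.List.Extrema.Nat using (max; xs≤max)
open import Data.List.Membership.Propositional using (_∈_; _∉_)
open import Data.List.Membership.Propositional.Properties using (∈-map⁺; ∈-++⁺ˡ; ∈-++⁺ʳ)
open import Data.List.NonEmpty using (_∷_)
open import Data.List.Properties using (foldl-∷ʳ; length-++; length-map)
open import Data.List.Relation.Binary.Subset.Propositional using (_⊆_)
open import Data.List.Relation.Binary.Subset.Propositional.Properties using (xs⊆xs++ys; xs⊆ys++xs; xs⊆x∷xs)
open import Data.List.Relation.Unary.All as All using (All; []; _∷_)
open import Data.List.Relation.Unary.All.Properties using (++⁺; ++⁻ˡ; ++⁻ʳ; ∷ʳ⁺; map⁺)
open import Data.List.Relation.Unary.Any using (here; there)
open import Data.Nat using (ℕ; zero; suc; _+_; _<_; s≤s)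
open import Data.Nat.Properties using (_≟_; <-cmp; <-irrefl; +-comm; m≤m+n; m≤n+m)
open import Data.List.Membership.DecPropositional _≟_ using (_∈?_)
open import Data.Product using (Σ; ∃; _×_; _,_; proj₁; proj₂)
open import Effect.Monad using (RawMonad)
open import Function using (_∘_; id)
open import Function.Bundles using (_⇔_; mk⇔; Equivalence)
open import Function.Definitions using (Injective)
open import Function.Endo.Propositional ℕ using (_^_)
open import Level using (0ℓ)
open import Relation.Binary.Definitions using (tri<; tri≈; tri>)
open import Relation.Binary.PropositionalEquality
  using (_≡_; _≢_; refl; sym; trans; cong; subst; module ≡-Reasoning)
open import Relation.Nullary using (¬_; Dec; yes; no; contradiction)
open import Relation.Nullary.Decidable using (decidable-stable; ¬¬-excluded-middle)
open import Relation.Nullary.Negation using (¬¬-Monad; ¬¬-map)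

open RawMonad (¬¬-Monad {0ℓ})

Inj : Map → Set
Inj = Injective _≡_ _≡_

Commute : Map → Map → Set
Commute f g = ∀ x → f (g x) ≡ g (f x)

AgreeOn : List ℕ → Map → Map → Set
AgreeOn D f g = ∀ x → x ∈ D → f x ≡ g x

AgreeOn-⊆ : ∀ {D E f g} → D ⊆ E → AgreeOn E f g → AgreeOn D f g
AgreeOn-⊆ D⊆E f~g x x∈D = f~g x (D⊆E x∈D)

AgreeOn-trans : ∀ {D f g h} → AgreeOn D f g → AgreeOn D g h → AgreeOn D f h
AgreeOn-trans f~g g~h x x∈D = trans (f~g x x∈D) (g~h x x∈D)

∘-fixes-agree : ∀ {D k} h → Fixes D k → AgreeOn D (h ∘ k) h
∘-fixes-agree h kD x x∈D = cong h (kD x x∈D)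

^-injective : ∀ {f} → Inj f → ∀ n → Inj (f ^ n)
^-injective f-inj zero e = e
^-injective f-inj (suc n) e = ^-injective f-inj n (f-inj e)

fresh : List ℕ → ℕ
fresh L = suc (max 0 L)

fresh∉ : ∀ L → fresh L ∉ L
fresh∉ L fresh∈L = <-irrefl refl (All.lookup (xs≤max 0 L) fresh∈L)

¬≈⇒¬¬witness : ∀ {f g} → ¬ f ≈ g → ¬ ¬ ∃ λ p → f p ≢ g p
¬≈⇒¬¬witness {f} {g} f≉g ¬witness =
  f≉g λ p → decidable-stable (f p ≟ g p) λ fp≢gp → ¬witness (p , fp≢gp)

FiniteSet-mono : ∀ {P Q : ℕ → Set} → (∀ y → P y → Q y) → FiniteSet Q → FiniteSet P
FiniteSet-mono P⊆Q (L , Q⊆L) = L , λ y Py → Q⊆L y (P⊆Q y Py)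

¬¬FiniteSet-⋃ : ∀ {R : ℕ → ℕ → Set} (M : List ℕ) → (∀ x → ¬ ¬ FiniteSet (R x)) →
                ¬ ¬ FiniteSet (λ y → ∃ λ x → x ∈ M × R x y)
¬¬FiniteSet-⋃ [] fibre = pure ([] , λ { y (x , () , _) })
¬¬FiniteSet-⋃ (x ∷ M) fibre = do
  (Lx , Rx⊆Lx) ← fibre x
  (L , ⋃⊆L) ← ¬¬FiniteSet-⋃ M fibre
  pure (Lx ++ L , λ where
    y (.x , here refl , Rxy) → ∈-++⁺ˡ (Rx⊆Lx y Rxy)
    y (x′ , there x′∈M , Rx′y) → ∈-++⁺ʳ Lx (⋃⊆L y (x′ , x′∈M , Rx′y)))

¬¬FiniteSet-preimage : ∀ {f} → Inj f → (L : List ℕ) → ¬ ¬ FiniteSet (λ y → f y ∈ L)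
¬¬FiniteSet-preimage {f} f-inj L =
  ¬¬-map (FiniteSet-mono λ y fy∈L → f y , fy∈L , refl) (¬¬FiniteSet-⋃ L fibre)
  where
  fibre : ∀ x → ¬ ¬ FiniteSet (λ y → f y ≡ x)
  fibre x = ¬¬-map finite ¬¬-excluded-middle
    where
    finite : Dec (∃ λ y → f y ≡ x) → FiniteSet (λ y → f y ≡ x)
    finite (yes (y₀ , fy₀≡x)) = y₀ ∷ [] , λ y fy≡x → here (f-inj (trans fy≡x (sym fy₀≡x)))
    finite (no ¬hit) = [] , λ y fy≡x → contradiction (y , fy≡x) ¬hit

run : List Map → Map → ℕ → ℕ
run cs s q = foldl (λ x c → c (s x)) q cs

run-∘ : ∀ A z g q → run A (z ∘ g) q ≡ run (map (_∘ z) A) g q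
run-∘ [] z g q = refl
run-∘ (c ∷ A) z g q = run-∘ A z g (c (z (g q)))

innermost : Map → List Map → Map
innermost l [] = l
innermost l (m ∷ ms) = innermost m ms

outer : Map → List Map → List Map
outer l [] = []
outer l (m ∷ ms) = outer m ms ∷ʳ l

evalL≡run : ∀ l ls s p → evalL l ls s p ≡ run (outer l ls) s (innermost l ls p)
evalL≡run l [] s p = refl
evalL≡run l (m ∷ ms) s p = begin
  l (s (evalL m ms s p))                          ≡⟨ cong (l ∘ s) (evalL≡run m ms s p) ⟩
  l (s (run (outer m ms) s (innermost m ms p)))   ≡⟨ sym (foldl-∷ʳ _ _ l (outer m ms)) ⟩
  run (outer m ms ∷ʳ l) s (innermost m ms p)      ∎
  where open ≡-Reasoning

length-outer : ∀ l ls → length (outer l ls) ≡ length ls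
length-outer l [] = refl
length-outer l (m ∷ ms) = begin
  length (outer m ms ++ l ∷ []) ≡⟨ length-++ (outer m ms) ⟩
  length (outer m ms) + 1       ≡⟨ +-comm _ 1 ⟩
  suc (length (outer m ms))     ≡⟨ cong suc (length-outer m ms) ⟩
  suc (length ms)               ∎
  where open ≡-Reasoning

All-innermost : ∀ {P : Subset} {l ls} → P l → All P ls → P (innermost l ls)
All-innermost Pl [] = Pl
All-innermost _ (Pm ∷ Pms) = All-innermost Pm Pms

All-outer : ∀ {P : Subset} {l ls} → P l → All P ls → All P (outer l ls)
All-outer _ [] = []
All-outer Pl (Pm ∷ Pms) = ∷ʳ⁺ (All-outer Pm Pms) Pl

queries : Map → List Map → Map → ℕ → List ℕ
queries l [] s p = []
queries l (m ∷ ms) s p = evalL m ms s p ∷ queries m ms s p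

evalL-local : ∀ l ls {s s′} p → AgreeOn (queries l ls s′ p) s s′ → evalL l ls s p ≡ evalL l ls s′ p
evalL-local l [] p _ = refl
evalL-local l (m ∷ ms) {s} {s′} p s~s′ = cong l (begin
  s (evalL m ms s p)   ≡⟨ cong s (evalL-local m ms p (AgreeOn-⊆ (xs⊆x∷xs _ _) s~s′)) ⟩
  s (evalL m ms s′ p)  ≡⟨ s~s′ _ (here refl) ⟩
  s′ (evalL m ms s′ p) ∎)
  where open ≡-Reasoning

evalL-∘-near : ∀ l ls {z g g₁} p → AgreeOn (queries l ls (z ∘ g₁) p) g g₁ →
               evalL l ls (z ∘ g) p ≡ run (map (_∘ z) (outer l ls)) g₁ (innermost l ls p)
evalL-∘-near l ls {z} {g} {g₁} p g~g₁ = begin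
  evalL l ls (z ∘ g) p                                 ≡⟨ evalL-local l ls p z∘g~z∘g₁ ⟩
  evalL l ls (z ∘ g₁) p                                ≡⟨ evalL≡run l ls (z ∘ g₁) p ⟩
  run (outer l ls) (z ∘ g₁) (innermost l ls p)         ≡⟨ run-∘ (outer l ls) z g₁ _ ⟩
  run (map (_∘ z) (outer l ls)) g₁ (innermost l ls p)  ∎
  where
  open ≡-Reasoning
  z∘g~z∘g₁ : AgreeOn (queries l ls (z ∘ g₁) p) (z ∘ g) (z ∘ g₁)
  z∘g~z∘g₁ x x∈ = cong z (g~g₁ x x∈)

Commute-^ : ∀ {f z} → Commute f z → ∀ n x → f ((z ^ n) x) ≡ (z ^ n) (f x)
Commute-^ fz≡zf zero x = refl
Commute-^ {z = z} fz≡zf (suc n) x = trans (fz≡zf _) (cong z (Commute-^ fz≡zf n x))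

evalL-shift : ∀ {z g l ls} → Commute l z → All (λ c → Commute c z) ls → Commute g z →
              ∀ p → evalL l ls (z ∘ g) p ≡ (z ^ length ls) (evalL l ls g p)
evalL-shift _ [] _ p = refl
evalL-shift {z} {g} {l} {m ∷ ms} lz≡zl (mz≡zm ∷ ms-commute) gz≡zg p = begin
  l (z (g (evalL m ms (z ∘ g) p)))   ≡⟨ cong (l ∘ z ∘ g) (evalL-shift mz≡zm ms-commute gz≡zg p) ⟩
  l (z (g ((z ^ length ms) e)))      ≡⟨ cong (l ∘ z) (Commute-^ gz≡zg (length ms) e) ⟩
  l ((z ^ suc (length ms)) (g e))    ≡⟨ Commute-^ {l} {z} lz≡zl (suc (length ms)) (g e) ⟩
  (z ^ suc (length ms)) (l (g e))    ∎
  where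
  open ≡-Reasoning
  e : ℕ
  e = evalL m ms g p

module _ (G : PermGroup) where

  mem-injective : ∀ {g} → mem G g → Inj g
  mem-injective {g} g∈G {x} {y} gx≡gy with inv∈ G g∈G
  ... | g⁻¹ , _ , g⁻¹g≈id , _ = begin
    x           ≡⟨ sym (g⁻¹g≈id x) ⟩
    g⁻¹ (g x)   ≡⟨ cong g⁻¹ gx≡gy ⟩
    g⁻¹ (g y)   ≡⟨ g⁻¹g≈id y ⟩
    y           ∎
    where open ≡-Reasoning

  mem⇒closure : ∀ {f} → mem G f → closure G f
  mem⇒closure {f} f∈G n = f , f∈G , λ _ _ → refl

  closure-injective : ∀ {f} → closure G f → Inj f
  closure-injective cl {x} {y} fx≡fy with cl (suc (x + y))
  ... | g , g∈G , g≈f = mem-injective g∈G (begin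
    g x ≡⟨ g≈f x (s≤s (m≤m+n x y)) ⟩
    _   ≡⟨ fx≡fy ⟩
    _   ≡⟨ sym (g≈f y (s≤s (m≤n+m y x))) ⟩
    g y ∎)
    where open ≡-Reasoning

  mem-commute : ∀ {f z} → (∀ g → mem G g → Commute z g) → mem G f → Commute f z
  mem-commute z-central f∈G x = sym (z-central _ f∈G x)

  closure-commute : ∀ {f z} → (∀ g → mem G g → Commute z g) → closure G f → Commute f z
  closure-commute {f} {z} z-central cl x with cl (suc (x + z x))
  ... | g , g∈G , g≈f = begin
    f (z x) ≡⟨ sym (g≈f (z x) (s≤s (m≤n+m (z x) x))) ⟩
    g (z x) ≡⟨ sym (z-central g g∈G x) ⟩
    z (g x) ≡⟨ cong z (g≈f x (s≤s (m≤m+n x (z x)))) ⟩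
    z (f x) ∎
    where open ≡-Reasoning

  HoldsNear : (Map → Set) → Map → List ℕ → Set
  HoldsNear P g₀ E = ∀ g → mem G g → AgreeOn E g g₀ → P g

  DenseOpen : (Map → Set) → Set
  DenseOpen P = ∀ g E → mem G g →
    ¬ ¬ ∃ λ g₁ → ∃ λ E₁ → mem G g₁ × AgreeOn E g₁ g × HoldsNear P g₁ E₁

  ¬¬HoldsNear-All : ∀ {I : Set} {Q : I → Map → Set} {g₀} (L : List I) →
                    All (λ i → ¬ ¬ ∃ (HoldsNear (Q i) g₀)) L →
                    ¬ ¬ ∃ (HoldsNear (λ g → All (λ i → Q i g) L) g₀)
  ¬¬HoldsNear-All [] [] = pure ([] , λ _ _ _ → [])
  ¬¬HoldsNear-All (i ∷ L) (near ∷ nears) = do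
    (E , Qi-near) ← near
    (E′ , QL-near) ← ¬¬HoldsNear-All L nears
    pure (E ++ E′ , λ g g∈G g~g₀ →
        Qi-near g g∈G (AgreeOn-⊆ (xs⊆xs++ys E E′) g~g₀)
      ∷ QL-near g g∈G (AgreeOn-⊆ (xs⊆ys++xs E′ E) g~g₀))

  HoldsNear-meets-DenseOpen : ∀ {I : Set} {P : Map → Set} {Q : I → Map → Set} {g₀ E} →
                              mem G g₀ → HoldsNear P g₀ E →
                              (L : List I) → All (λ i → DenseOpen (Q i)) L →
                              ¬ ¬ ∃ λ g → mem G g × P g × All (λ i → Q i g) L
  HoldsNear-meets-DenseOpen g₀∈G P-near [] [] = pure (_ , g₀∈G , P-near _ g₀∈G (λ _ _ → refl) , [])
  HoldsNear-meets-DenseOpen {P = P} {Q} {g₀} {E} g₀∈G P-near (i ∷ L) (Qi-dense ∷ QL-dense) = do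
    (g₁ , E₁ , g₁∈G , g₁~g₀ , Qi-near) ← Qi-dense g₀ E g₀∈G
    let PQi-near : HoldsNear (λ g → P g × Q i g) g₁ (E ++ E₁)
        PQi-near g g∈G g~g₁ =
            P-near g g∈G (AgreeOn-trans (AgreeOn-⊆ (xs⊆xs++ys E E₁) g~g₁) g₁~g₀)
          , Qi-near g g∈G (AgreeOn-⊆ (xs⊆ys++xs E₁ E) g~g₁)
    (g , g∈G , (Pg , Qig) , QLg) ← HoldsNear-meets-DenseOpen g₁∈G PQi-near L QL-dense
    pure (g , g∈G , Pg , Qig ∷ QLg)

  Orbit : List ℕ → ℕ → ℕ → Set
  Orbit D a x = Σ Map λ k → mem G k × Fixes D k × k a ≡ x

  Orbit₂ : List ℕ → ℕ → ℕ → ℕ → ℕ → Set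
  Orbit₂ D a b x y = Σ Map λ k → mem G k × Fixes D k × k a ≡ x × k b ≡ y

  ¬acl⇒escape : ∀ {D a} → ¬ acl G D a → (M : List ℕ) →
                ¬ ¬ ∃ λ k → mem G k × Fixes D k × k a ∉ M
  ¬acl⇒escape {D} {a} a∉acl M no-escape = a∉acl (M , orbit⊆M)
    where
    orbit⊆M : ∀ y → Orbit D a y → y ∈ M
    orbit⊆M y (k , k∈G , kD , refl) =
      decidable-stable (k a ∈? M) λ ka∉M → no-escape (k , k∈G , kD , ka∉M)

  ¬acl⇒escape-injective : ∀ {D a f} → ¬ acl G D a → Inj f → (L : List ℕ) →
                          ¬ ¬ ∃ λ k → mem G k × Fixes D k × f (k a) ∉ L
  ¬acl⇒escape-injective a∉acl f-inj L = do
    (M , f⁻¹L⊆M) ← ¬¬FiniteSet-preimage f-inj L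
    (k , k∈G , kD , ka∉M) ← ¬acl⇒escape a∉acl M
    pure (k , k∈G , kD , λ fka∈L → ka∉M (f⁻¹L⊆M _ fka∈L))

  -- If kₓ a = k a with kₓ, k ∈ G_D then kₓ⁻¹ k ∈ G_{a,D}, so k b lies in the kₓ-image of the
  -- G_{a,D}-orbit of b.
  acl∷⇒¬¬FiniteSet-fibre : ∀ {D a b} → acl G (a ∷ D) b → ∀ x → ¬ ¬ FiniteSet (Orbit₂ D a b x)
  acl∷⇒¬¬FiniteSet-fibre {D} {a} {b} (Lb , orbit⊆Lb) x = ¬¬-map finite ¬¬-excluded-middle
    where
    finite : Dec (Orbit D a x) → FiniteSet (Orbit₂ D a b x)
    finite (no ¬hit) = [] , λ { y (k , k∈G , kD , ka≡x , _) → contradiction (k , k∈G , kD , ka≡x) ¬hit }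
    finite (yes (kₓ , kₓ∈G , kₓD , kₓa≡x)) with inv∈ G kₓ∈G
    ... | kₓ⁻¹ , kₓ⁻¹∈G , kₓ⁻¹kₓ≈id , kₓkₓ⁻¹≈id = map kₓ Lb , fibre⊆
      where
      fibre⊆ : ∀ y → Orbit₂ D a b x y → y ∈ map kₓ Lb
      fibre⊆ y (k , k∈G , kD , ka≡x , refl) =
        subst (_∈ map kₓ Lb) (kₓkₓ⁻¹≈id (k b))
          (∈-map⁺ kₓ (orbit⊆Lb _ (kₓ⁻¹ ∘ k , comp∈ G kₓ⁻¹∈G k∈G , kₓ⁻¹k-fixes , refl)))
        where
        kₓ⁻¹k-fixes : Fixes (a ∷ D) (kₓ⁻¹ ∘ k)
        kₓ⁻¹k-fixes _ (here refl) = trans (cong kₓ⁻¹ (trans ka≡x (sym kₓa≡x))) (kₓ⁻¹kₓ≈id a)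
        kₓ⁻¹k-fixes d (there d∈D) =
          trans (cong kₓ⁻¹ (trans (kD d d∈D) (sym (kₓD d d∈D)))) (kₓ⁻¹kₓ≈id d)

  escape₂-independent : ∀ {D a b f₁ f₂} → ¬ acl G D a → ¬ acl G (a ∷ D) b → Inj f₁ → Inj f₂ →
                        (L : List ℕ) → ¬ ¬ ∃ λ k → mem G k × Fixes D k × f₁ (k a) ∉ L × f₂ (k b) ∉ L
  escape₂-independent {D} {a} {f₁ = f₁} a∉acl b∉acl f₁-inj f₂-inj L = do
    (k₁ , k₁∈G , k₁D , f₁k₁a∉L) ← ¬acl⇒escape-injective a∉acl f₁-inj L
    (k₂ , k₂∈G , k₂aD , f₂k₁k₂b∉L) ←
      ¬acl⇒escape-injective b∉acl (mem-injective k₁∈G ∘ f₂-inj) L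
    pure (k₁ ∘ k₂ , comp∈ G k₁∈G k₂∈G
         , AgreeOn-trans (∘-fixes-agree k₁ (AgreeOn-⊆ (xs⊆x∷xs D a) k₂aD)) k₁D
         , subst (λ u → f₁ (k₁ u) ∉ L) (sym (k₂aD a (here refl))) f₁k₁a∉L
         , f₂k₁k₂b∉L)

  escape₂-algebraic : ∀ {D a b f₁ f₂} → ¬ acl G D b → acl G (a ∷ D) b → Inj f₁ → Inj f₂ →
                      (L : List ℕ) → ¬ ¬ ∃ λ k → mem G k × Fixes D k × f₁ (k a) ∉ L × f₂ (k b) ∉ L
  escape₂-algebraic {a = a} {b} {f₂ = f₂} b∉acl b∈acl f₁-inj f₂-inj L = do
    (M , f₁⁻¹L⊆M) ← ¬¬FiniteSet-preimage f₁-inj L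
    (Y , fibres⊆Y) ← ¬¬FiniteSet-⋃ M (acl∷⇒¬¬FiniteSet-fibre b∈acl)
    (k , k∈G , kD , f₂kb∉) ← ¬acl⇒escape-injective b∉acl f₂-inj (L ++ map f₂ Y)
    let kb∈Y : k a ∈ M → k b ∈ Y
        kb∈Y ka∈M = fibres⊆Y (k b) (k a , ka∈M , k , k∈G , kD , refl , refl)
    pure (k , k∈G , kD
         , (λ f₁ka∈L → f₂kb∉ (∈-++⁺ʳ L (∈-map⁺ f₂ (kb∈Y (f₁⁻¹L⊆M _ f₁ka∈L)))))
         , (λ f₂kb∈L → f₂kb∉ (∈-++⁺ˡ f₂kb∈L)))

  ¬acl⇒escape₂ : ∀ {D a b f₁ f₂} → ¬ acl G D a → ¬ acl G D b → Inj f₁ → Inj f₂ →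
                 (L : List ℕ) → ¬ ¬ ∃ λ k → mem G k × Fixes D k × f₁ (k a) ∉ L × f₂ (k b) ∉ L
  ¬acl⇒escape₂ {D} {a} {b} a∉acl b∉acl f₁-inj f₂-inj L =
    ¬¬-excluded-middle {A = acl G (a ∷ D) b} >>= λ where
      (yes b∈acl) → escape₂-algebraic b∉acl b∈acl f₁-inj f₂-inj L
      (no b∉acl′) → escape₂-independent a∉acl b∉acl′ f₁-inj f₂-inj L

  module _ (lfa : LocallyFiniteAcl G) where

    aclList : List ℕ → List ℕ
    aclList D = proj₁ (lfa D)

    ∉aclList⇒¬acl : ∀ {D x} → x ∉ aclList D → ¬ acl G D x
    ∉aclList⇒¬acl x∉ x∈acl = x∉ (proj₂ (lfa _) _ x∈acl)

    run-avoids : ∀ {D h a} l A → Inj l → All Inj A → mem G h → ¬ acl G D a → ∀ v →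
                 ¬ ¬ ∃ λ h′ → mem G h′ × AgreeOn D h′ h × run (l ∷ A) h′ a ≢ v
    run-avoids {h = h} l [] l-inj _ h∈G a∉acl v = do
      (k , k∈G , kD , lhka≢v) ← ¬acl⇒escape-injective a∉acl (mem-injective h∈G ∘ l-inj) (v ∷ [])
      pure (h ∘ k , comp∈ G h∈G k∈G , ∘-fixes-agree h kD , lhka≢v ∘ here)
    run-avoids {D} {h} {a} l (l′ ∷ A) l-inj (l′-inj ∷ A-inj) h∈G a∉acl v = do
      (k , k∈G , kD , a′∉) ←
        ¬acl⇒escape-injective a∉acl (mem-injective h∈G ∘ l-inj) (aclList (a ∷ D))
      (h′ , h′∈G , h′~hk , run≢v) ←
        run-avoids l′ A l′-inj A-inj (comp∈ G h∈G k∈G) (∉aclList⇒¬acl a′∉) v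
      pure (h′ , h′∈G
           , AgreeOn-trans (AgreeOn-⊆ (xs⊆x∷xs D a) h′~hk) (∘-fixes-agree h kD)
           , λ run≡v → run≢v (subst (λ u → run (l′ ∷ A) h′ (l u) ≡ v) (h′~hk a (here refl)) run≡v))

    -- Each step replaces h by h ∘ k with k ∈ G_D chosen so that the next inputs l (h (k a)) and
    -- m (h (k b)) are not algebraic over a ∷ b ∷ D; once B is used up, the A-run only has to
    -- avoid the value b.
    runs-differ-< : ∀ {D h a b} A B → All Inj A → All Inj B → length B < length A →
                    mem G h → ¬ acl G D a → ¬ acl G D b →
                    ¬ ¬ ∃ λ h′ → mem G h′ × AgreeOn D h′ h × run A h′ a ≢ run B h′ b
    runs-differ-< {b = b} (l ∷ A) [] (l-inj ∷ A-inj) _ _ h∈G a∉acl _ =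
      run-avoids l A l-inj A-inj h∈G a∉acl b
    runs-differ-< {D} {h} {a} {b} (l ∷ A) (m ∷ B) (l-inj ∷ A-inj) (m-inj ∷ B-inj) (s≤s |B|<|A|)
                  h∈G a∉acl b∉acl = do
      (k , k∈G , kD , a′∉ , b′∉) ← ¬acl⇒escape₂ a∉acl b∉acl
        (mem-injective h∈G ∘ l-inj) (mem-injective h∈G ∘ m-inj) (aclList (a ∷ b ∷ D))
      (h′ , h′∈G , h′~hk , runs≢) ← runs-differ-< A B A-inj B-inj |B|<|A| (comp∈ G h∈G k∈G)
        (∉aclList⇒¬acl a′∉) (∉aclList⇒¬acl b′∉)
      pure (h′ , h′∈G
           , AgreeOn-trans (AgreeOn-⊆ (xs⊆ys++xs D (a ∷ b ∷ [])) h′~hk) (∘-fixes-agree h kD)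
           , λ runs≡ → runs≢ (trans (cong (λ u → run A h′ (l u)) (sym (h′~hk a (here refl))))
                               (trans runs≡ (cong (λ u → run B h′ (m u)) (h′~hk b (there (here refl)))))))

    runs-differ : ∀ {D h a b} A B → All Inj A → All Inj B → length A ≢ length B →
                  mem G h → ¬ acl G D a → ¬ acl G D b →
                  ¬ ¬ ∃ λ h′ → mem G h′ × AgreeOn D h′ h × run A h′ a ≢ run B h′ b
    runs-differ A B A-inj B-inj |A|≢|B| h∈G a∉acl b∉acl with <-cmp (length A) (length B)
    ... | tri< |A|<|B| _ _ = do
      (h′ , h′∈G , h′~h , runs≢) ← runs-differ-< B A B-inj A-inj |A|<|B| h∈G b∉acl a∉acl
      pure (h′ , h′∈G , h′~h , runs≢ ∘ sym)
    ... | tri≈ _ |A|≡|B| _ = contradiction |A|≡|B| |A|≢|B|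
    ... | tri> _ _ |B|<|A| = runs-differ-< A B A-inj B-inj |B|<|A| h∈G a∉acl b∉acl

    runs-differ-near : ∀ {c d g} A B → Inj c → Inj d → All Inj A → All Inj B →
                       length A ≢ length B → mem G g → (E : List ℕ) →
                       ¬ ¬ ∃ λ g′ → ∃ λ p → mem G g′ × AgreeOn E g′ g ×
                                            run A g′ (c p) ≢ run B g′ (d p)
    runs-differ-near A B c-inj d-inj A-inj B-inj |A|≢|B| g∈G E = do
      (k , _ , _ , ckq∉ , dkq∉) ← ¬acl⇒escape₂ q∉acl q∉acl c-inj d-inj (aclList E)
      (g′ , g′∈G , g′~g , runs≢) ← runs-differ A B A-inj B-inj |A|≢|B| g∈G
        (∉aclList⇒¬acl ckq∉) (∉aclList⇒¬acl dkq∉)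
      pure (g′ , k q , g′∈G , g′~g , runs≢)
      where
      q : ℕ
      q = fresh (aclList E)
      q∉acl : ¬ acl G E q
      q∉acl = ∉aclList⇒¬acl (fresh∉ (aclList E))

module _ (G : PermGroup) (lfa : LocallyFiniteAcl G) {z : Map} (z∈G : mem G z)
         (z-central : ∀ g → mem G g → Commute z g) {S : Subset} (G⊆S : ∀ {f} → mem G f → S f)
         (S-injective : ∀ {f} → S f → Inj f) (S-commute : ∀ {f} → S f → Commute f z) where

  Balanced : Ineq S → Set
  Balanced ((_ ∷ ls₁ , _ ∷ ls₂) , _) = length ls₁ ≡ length ls₂

  balanced? : ∀ i → Dec (Balanced i)
  balanced? ((_ ∷ ls₁ , _ ∷ ls₂) , _) = length ls₁ ≟ length ls₂

  evalL-shift-near : ∀ {l ls g} → S l → All S ls → mem G g → ∀ p → AgreeOn (queries l ls id p) g id →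
                     evalL l ls (z ∘ g) p ≡ (z ^ length ls) (evalL l ls id p)
  evalL-shift-near {l} {ls} {g} Sl Sls g∈G p g~id = begin
    evalL l ls (z ∘ g) p                ≡⟨ evalL-shift (S-commute Sl) (All.map S-commute Sls) g-commute p ⟩
    (z ^ length ls) (evalL l ls g p)    ≡⟨ cong (z ^ length ls) (evalL-local l ls p g~id) ⟩
    (z ^ length ls) (evalL l ls id p)   ∎
    where
    open ≡-Reasoning
    g-commute : Commute g z
    g-commute = mem-commute G z-central g∈G

  balanced-shift : ∀ {l₁ ls₁ l₂ ls₂ g} p → S l₁ → All S ls₁ → S l₂ → All S ls₂ →
                   length ls₁ ≡ length ls₂ → mem G g →
                   AgreeOn (queries l₁ ls₁ id p ++ queries l₂ ls₂ id p) g id →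
                   (evalL l₁ ls₁ (z ∘ g) p ≡ evalL l₂ ls₂ (z ∘ g) p) ⇔ (evalL l₁ ls₁ id p ≡ evalL l₂ ls₂ id p)
  balanced-shift {ls₂ = ls₂} p Sl₁ Sls₁ Sl₂ Sls₂ |ls₁|≡|ls₂| g∈G g~id
    rewrite evalL-shift-near Sl₁ Sls₁ g∈G p (AgreeOn-⊆ (xs⊆xs++ys _ _) g~id)
          | evalL-shift-near Sl₂ Sls₂ g∈G p (AgreeOn-⊆ (xs⊆ys++xs _ _) g~id)
          | |ls₁|≡|ls₂|
    = mk⇔ (^-injective (mem-injective G z∈G) (length ls₂)) (cong (z ^ length ls₂))

  balanced-at-z⇒at-id : ∀ i → Balanced i → Solves {S} i z → Solves {S} i id
  balanced-at-z⇒at-id ((_ ∷ _ , _ ∷ _) , (Sl₁ , Sls₁) , (Sl₂ , Sls₂)) bal z-solves id-equal =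
    z-solves λ p →
      Equivalence.from (balanced-shift p Sl₁ Sls₁ Sl₂ Sls₂ bal (id∈ G) (λ _ _ → refl)) (id-equal p)

  balanced-solved-near-id : ∀ i → Balanced i → Solves {S} i id →
                            ¬ ¬ ∃ (HoldsNear G (λ g → Solves {S} i (z ∘ g)) id)
  balanced-solved-near-id ((l₁ ∷ ls₁ , l₂ ∷ ls₂) , (Sl₁ , Sls₁) , (Sl₂ , Sls₂)) bal id-solves = do
    (p , id-differ) ← ¬≈⇒¬¬witness id-solves
    pure (queries l₁ ls₁ id p ++ queries l₂ ls₂ id p , λ g g∈G g~id z∘g-equal →
      id-differ (Equivalence.to (balanced-shift p Sl₁ Sls₁ Sl₂ Sls₂ bal g∈G g~id) (z∘g-equal p)))

  unbalanced-solved-densely : ∀ i → DenseOpen G (λ g → ¬ Balanced i → Solves {S} i (z ∘ g))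
  unbalanced-solved-densely i g E g∈G with balanced? i
  ... | yes bal = pure (g , [] , g∈G , (λ _ _ → refl) , λ _ _ _ ¬bal → contradiction bal ¬bal)
  unbalanced-solved-densely ((l₁ ∷ ls₁ , l₂ ∷ ls₂) , (Sl₁ , Sls₁) , (Sl₂ , Sls₂)) g E g∈G
    | no ¬bal = do
    (g₁ , p , g₁∈G , g₁~g , runs≢) ← runs-differ-near G lfa A₁ A₂
      (S-injective (All-innermost Sl₁ Sls₁)) (S-injective (All-innermost Sl₂ Sls₂))
      (constants-injective Sl₁ Sls₁) (constants-injective Sl₂ Sls₂) |A₁|≢|A₂| g∈G E
    pure (g₁ , queries l₁ ls₁ (z ∘ g₁) p ++ queries l₂ ls₂ (z ∘ g₁) p , g₁∈G , g₁~g ,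
      λ g′ g′∈G g′~g₁ _ z∘g′-equal → runs≢ (begin
        run A₁ g₁ (innermost l₁ ls₁ p)
          ≡⟨ sym (evalL-∘-near l₁ ls₁ p (AgreeOn-⊆ (xs⊆xs++ys _ _) g′~g₁)) ⟩
        evalL l₁ ls₁ (z ∘ g′) p
          ≡⟨ z∘g′-equal p ⟩
        evalL l₂ ls₂ (z ∘ g′) p
          ≡⟨ evalL-∘-near l₂ ls₂ p (AgreeOn-⊆ (xs⊆ys++xs _ _) g′~g₁) ⟩
        run A₂ g₁ (innermost l₂ ls₂ p) ∎))
    where
    open ≡-Reasoning
    A₁ A₂ : List Map
    A₁ = map (_∘ z) (outer l₁ ls₁)
    A₂ = map (_∘ z) (outer l₂ ls₂)
    ∘z-injective : ∀ {c} → S c → Inj (c ∘ z)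
    ∘z-injective Sc e = mem-injective G z∈G (S-injective Sc e)
    constants-injective : ∀ {l ls} → S l → All S ls → All Inj (map (_∘ z) (outer l ls))
    constants-injective Sl Sls = map⁺ (All.map ∘z-injective (All-outer Sl Sls))
    |A₁|≢|A₂| : length A₁ ≢ length A₂
    |A₁|≢|A₂| |A₁|≡|A₂| = ¬bal (begin
      length ls₁            ≡⟨ sym (length-outer l₁ ls₁) ⟩
      length (outer l₁ ls₁) ≡⟨ sym (length-map (_∘ z) (outer l₁ ls₁)) ⟩
      length A₁             ≡⟨ |A₁|≡|A₂| ⟩
      length A₂             ≡⟨ length-map (_∘ z) (outer l₂ ls₂) ⟩
      length (outer l₂ ls₂) ≡⟨ length-outer l₂ ls₂ ⟩
      length ls₂            ∎)

  solved-near-id : ∀ i → (Balanced i → Solves {S} i id) →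
                   ¬ ¬ ∃ (HoldsNear G (λ g → Balanced i → Solves {S} i (z ∘ g)) id)
  solved-near-id i id-solves with balanced? i
  ... | yes bal = do
    (E , solved-near) ← balanced-solved-near-id i bal (id-solves bal)
    pure (E , λ g g∈G g~id _ → solved-near g g∈G g~id)
  ... | no ¬bal = pure ([] , λ _ _ _ bal → contradiction bal ¬bal)

  common-solution : (L : List (Ineq S)) → All (λ i → Balanced i → Solves {S} i id) L →
                    ¬ ¬ ∃ λ g → mem G g × All (λ i → Solves {S} i (z ∘ g)) L
  common-solution L id-solves = do
    (E , balanced-near) ← ¬¬HoldsNear-All G L (All.map (λ {i} → solved-near-id i) id-solves)
    (g , g∈G , balanced-solved , unbalanced-solved) ←
      HoldsNear-meets-DenseOpen G (id∈ G) balanced-near L (All.universal unbalanced-solved-densely L)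
    pure (g , g∈G , All.zipWith (λ {i} → solved {i}) (balanced-solved , unbalanced-solved))
    where
    solved : ∀ {i g} → (Balanced i → Solves {S} i g) × (¬ Balanced i → Solves {S} i g) → Solves {S} i g
    solved {i} (if-bal , if-unbal) with balanced? i
    ... | yes bal = if-bal bal
    ... | no ¬bal = if-unbal ¬bal

  zariski-not-hausdorff : ¬ z ≈ id → ¬ ZariskiHausdorff S
  zariski-not-hausdorff z≉id hausdorff
    with hausdorff id z (G⊆S (id∈ G)) (G⊆S z∈G) (λ id≈z → z≉id (λ x → sym (id≈z x)))
  ... | U , V , (_ , U-open) , (_ , V-open) , id∈U , z∈V , U∩V≡∅
    with U-open id id∈U | V-open z z∈V
  ... | L₁ , (_ , id-solves) , L₁⊆U | L₂ , (_ , z-solves) , L₂⊆V =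
    common-solution (L₁ ++ L₂) id-solves-balanced λ (g , g∈G , solves) →
      U∩V≡∅ (z ∘ g) (L₁⊆U (z ∘ g) (z∘g∈S g∈G , ++⁻ˡ L₁ solves))
                    (L₂⊆V (z ∘ g) (z∘g∈S g∈G , ++⁻ʳ L₁ solves))
    where
    id-solves-balanced : All (λ i → Balanced i → Solves {S} i id) (L₁ ++ L₂)
    id-solves-balanced = ++⁺ (All.map (λ solves _ → solves) id-solves)
                             (All.map (λ {i} solves bal → balanced-at-z⇒at-id i bal solves) z-solves)
    z∘g∈S : ∀ {g} → mem G g → S (z ∘ g)
    z∘g∈S g∈G = G⊆S (comp∈ G z∈G g∈G)

theorem4p8 : (G : PermGroup) → LocallyFiniteAcl G → NontrivialCentre G →
    ¬ ZariskiHausdorff (closure G) × ¬ ZariskiHausdorff (mem G)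
theorem4p8 G lfa (z , z∈G , z≉id , z-central) =
    zariski-not-hausdorff G lfa z∈G z-central
      (mem⇒closure G) (closure-injective G) (closure-commute G z-central) z≉id
  , zariski-not-hausdorff G lfa z∈G z-central id (mem-injective G) (mem-commute G z-central) z≉id
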